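{- Let $(a,b,x,y)$ be a rectangular donut. Then $(a,b,x,y)$ has a twistable hole (that is, $(a,b,y,x)$ is also a rectangular donut) if and only if both $2x > a$ and $2y > a$.
   Context: All numbers are positive integers. A rectangular donut is an ordered quadruple $(a,b,x,y)$ of positive integers such that $1 < b \le a < ab$, $ab = 2xy$, $1 \le x < a$ and $1 \le y < b$. (Geometrically: an $a\times b$ rectangle containing an $x \times y$ rectangle with the side of length $x$ parallel to the side of length $a$, the larger rectangle having twice the area of the smaller.) The donut $(a,b,x,y)$ is said to have a twistable hole if $(a,b,y,x)$ is also a rectangular donut, i.e. $ab=2xy$, $1\le y<a$ and $1\le x<b$. -}

module Defs where

open import Data.Nat using (ℕ; _*_; _≤_; _<_)
open import Data.Product using (_×_)
open import Relation.Binary.PropositionalEquality using (_≡_)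

RectDonut : ℕ → ℕ → ℕ → ℕ → Set
RectDonut a b x y =
  (1 < b) × (b ≤ a) × (a < a * b) × (a * b ≡ 2 * (x * y)) ×
  (1 ≤ x) × (x < a) × (1 ≤ y) × (y < b)

TwistableHole : ℕ → ℕ → ℕ → ℕ → Set
TwistableHole a b x y = RectDonut a b y x

-- Since ab = (2x)y, comparing with the rectangle of sides a and y shows that
-- y < b holds exactly when a < 2x; likewise ab = (2y)x gives x < b ⇔ a < 2y.
-- The donut hypothesis y < b therefore forces a < 2x, and the twisted donut
-- (a,b,y,x) needs, beyond what (a,b,x,y) already provides (y < b ≤ a), only x < b.
module Submission where

open import Defs
open import Data.Nat using (ℕ; _*_; _<_; NonZero; >-nonZero)
open import Data.Nat.Properties
  using (*-comm; *-assoc; *-cancelʳ-<; *-cancelˡ-<; *-monoʳ-<; *-monoˡ-<; m*n≢0; <-≤-trans)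
open import Data.Product using (_×_; _,_)
open import Function.Bundles using (_⇔_; mk⇔; Equivalence)
open import Relation.Binary.PropositionalEquality using (_≡_; sym; trans; cong; subst)

*≡*⇒[<⇔<] : ∀ {a b c d} .{{_ : NonZero c}} .{{_ : NonZero d}} →
            a * b ≡ c * d → (d < b ⇔ a < c)
*≡*⇒[<⇔<] {a} {b} {c} {d} ab≡cd = mk⇔ to from
  where
  to : d < b → a < c
  to d<b = *-cancelʳ-< b a c (subst (_< c * b) (sym ab≡cd) (*-monoʳ-< c d<b))

  from : a < c → d < b
  from a<c = *-cancelˡ-< a d b (subst (a * d <_) (sym ab≡cd) (*-monoˡ-< d a<c))

2*[m*n]≡[2*m]*n : ∀ m n → 2 * (m * n) ≡ 2 * m * n
2*[m*n]≡[2*m]*n m n = sym (*-assoc 2 m n)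

2*[m*n]≡[2*n]*m : ∀ m n → 2 * (m * n) ≡ 2 * n * m
2*[m*n]≡[2*n]*m m n = trans (cong (2 *_) (*-comm m n)) (2*[m*n]≡[2*m]*n n m)

theorem2 : (a b x y : ℕ) → RectDonut a b x y →
    (TwistableHole a b x y ⇔ ((a < 2 * x) × (a < 2 * y)))
theorem2 a b x y (1<b , b≤a , a<ab , ab≡2xy , 1≤x , x<a , 1≤y , y<b) = mk⇔ to from
  where
  instance
    x≢0 : NonZero x
    x≢0 = >-nonZero 1≤x
    y≢0 : NonZero y
    y≢0 = >-nonZero 1≤y
    2x≢0 : NonZero (2 * x)
    2x≢0 = m*n≢0 2 x
    2y≢0 : NonZero (2 * y)
    2y≢0 = m*n≢0 2 y

  y<b⇔a<2x : y < b ⇔ a < 2 * x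
  y<b⇔a<2x = *≡*⇒[<⇔<] (trans ab≡2xy (2*[m*n]≡[2*m]*n x y))

  x<b⇔a<2y : x < b ⇔ a < 2 * y
  x<b⇔a<2y = *≡*⇒[<⇔<] (trans ab≡2xy (2*[m*n]≡[2*n]*m x y))

  to : TwistableHole a b x y → (a < 2 * x) × (a < 2 * y)
  to (_ , _ , _ , _ , _ , _ , _ , x<b) =
    Equivalence.to y<b⇔a<2x y<b , Equivalence.to x<b⇔a<2y x<b

  from : (a < 2 * x) × (a < 2 * y) → TwistableHole a b x y
  from (_ , a<2y) =
    1<b , b≤a , a<ab , trans ab≡2xy (cong (2 *_) (*-comm x y)) ,
    1≤y , <-≤-trans y<b b≤a , 1≤x , Equivalence.from x<b⇔a<2y a<2y
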